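{- Let $G$ be a finite group and $H$ a proper subgroup of $G$. Then $H$ is a perfect code of $G$ if and only if there exists a left or right transversal of $H$ in $G$ which contains $e$ and is inverse-closed. In particular, if there exists $x\in G\setminus H$ such that $xH$ or $Hx$ is inverse-closed and contains no involutions, then $H$ is not a perfect code of $G$.
   Context: For an inverse-closed subset $S\subseteq G$ with $e\notin S$, the Cayley graph $\mathrm{Cay}(G,S)$ has vertex set $G$, with distinct $x,y$ adjacent iff $yx^{ -1}\in S$. A subset $C$ of the vertex set of a graph is a perfect code if it is independent and every vertex outside $C$ is adjacent to exactly one vertex of $C$. A subset $C$ of $G$ is a perfect code of $G$ if some Cayley graph $\mathrm{Cay}(G,S)$ admits $C$ as a perfect code. -}

module Defs where

open import Level using (0ℓ)
open import Data.Bool using (Bool; true)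
open import Data.Nat using (ℕ)
open import Data.Fin using (Fin)
open import Data.Product using (Σ; ∃; _×_; _,_)
open import Data.Sum using (_⊎_)
open import Relation.Nullary using (¬_)
open import Relation.Binary.PropositionalEquality using (_≡_)
open import Algebra.Structures using (IsGroup)
open import Function.Bundles using (_↔_)

record FiniteGroup : Set₁ where
  infixl 7 _∙_
  infix 8 _⁻¹
  field
    Carrier : Set
    _∙_     : Carrier → Carrier → Carrier
    ε       : Carrier
    _⁻¹     : Carrier → Carrier
    isGroup : IsGroup _≡_ _∙_ ε _⁻¹
    size    : ℕ
    enum    : Carrier ↔ Fin size

module _ (G : FiniteGroup) where
  open FiniteGroup G

  -- Subsets of the finite set G (classically every subset is decidable).
  Subset : Set
  Subset = Carrier → Bool

  infix 4 _∈_ _∉_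
  _∈_ : Carrier → Subset → Set
  x ∈ A = A x ≡ true

  _∉_ : Carrier → Subset → Set
  x ∉ A = ¬ (x ∈ A)

  IsSubgroup : Subset → Set
  IsSubgroup H = (ε ∈ H)
               × (∀ x y → x ∈ H → y ∈ H → x ∙ y ∈ H)
               × (∀ x → x ∈ H → x ⁻¹ ∈ H)

  IsProperSubgroup : Subset → Set
  IsProperSubgroup H = IsSubgroup H × (∃ λ x → x ∉ H)

  InverseClosed : Subset → Set
  InverseClosed A = ∀ x → x ∈ A → x ⁻¹ ∈ A

  IsConnectionSet : Subset → Set
  IsConnectionSet S = InverseClosed S × (ε ∉ S)

  Adj : Subset → Carrier → Carrier → Set
  Adj S x y = (¬ x ≡ y) × (y ∙ x ⁻¹ ∈ S)

  IsPerfectCodeIn : Subset → Subset → Set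
  IsPerfectCodeIn S C =
      (∀ x y → x ∈ C → y ∈ C → ¬ Adj S x y)
    × (∀ v → v ∉ C →
         (∃ λ c → c ∈ C × Adj S c v)
         × (∀ c c′ → c ∈ C → c′ ∈ C → Adj S c v → Adj S c′ v → c ≡ c′))

  IsPerfectCodeOf : Subset → Set
  IsPerfectCodeOf C = ∃ λ S → IsConnectionSet S × IsPerfectCodeIn S C

  leftCoset : Carrier → Subset → Subset
  leftCoset x H y = H (x ⁻¹ ∙ y)

  rightCoset : Subset → Carrier → Subset
  rightCoset H x y = H (y ∙ x ⁻¹)

  IsLeftTransversal : Subset → Subset → Set
  IsLeftTransversal H T =
    ∀ x → (∃ λ t → t ∈ T × t ∈ leftCoset x H)
        × (∀ t t′ → t ∈ T → t′ ∈ T → t ∈ leftCoset x H → t′ ∈ leftCoset x H → t ≡ t′)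

  IsRightTransversal : Subset → Subset → Set
  IsRightTransversal H T =
    ∀ x → (∃ λ t → t ∈ T × t ∈ rightCoset H x)
        × (∀ t t′ → t ∈ T → t′ ∈ T → t ∈ rightCoset H x → t′ ∈ rightCoset H x → t ≡ t′)

  IsInvolution : Carrier → Set
  IsInvolution y = (¬ y ≡ ε) × (y ∙ y ≡ ε)

  NoInvolutions : Subset → Set
  NoInvolutions A = ∀ y → y ∈ A → ¬ IsInvolution y

-- In Cay(G,S) the closed neighbourhood of c is (S ∪ {e})c, so a subset H is a perfect code
-- exactly when every v ∈ G factors uniquely as v = t c with t ∈ T := S ∪ {e} and c ∈ H.
-- For inverse-closed H this says that every left coset vH meets T exactly once, i.e. T is a
-- left transversal; conversely S := T ∖ {e} recovers a connection set from a transversal.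
-- Inversion maps left cosets onto right cosets, so for inverse-closed T left and right
-- transversals coincide. Finally, if T is inverse-closed and meets an inverse-closed coset
-- xH ≠ H in a single element t, then t = t⁻¹ ≠ e, so xH contains an involution.
module Submission where

open import Algebra.Bundles using (Group)
import Algebra.Properties.Group as GroupProperties
open import Algebra.Structures using (IsGroup)
open import Data.Bool using (_∧_; _∨_; not)
import Data.Bool as Bool
open import Data.Empty using (⊥-elim)
import Data.Fin as Fin
open import Data.Product using (∃; _×_; _,_; proj₂)
open import Data.Sum using (_⊎_; inj₁; inj₂; [_,_])
open import Function.Base using (id)
open import Function.Bundles using (_⇔_; mk⇔; Equivalence)
open import Function.Properties.Inverse using (↔⇒↣)
open import Level using (0ℓ)
open import Relation.Binary.Definitions using (DecidableEquality)
open import Relation.Binary.PropositionalEquality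
  using (_≡_; refl; sym; trans; cong; subst; module ≡-Reasoning)
open import Relation.Nullary using (¬_; yes; no; does)
open import Relation.Nullary.Decidable using (via-injection)
open import Defs hiding (_∈_; _∉_)
import Defs

module _ (G : FiniteGroup) where
  open FiniteGroup G
  open IsGroup isGroup using (identityˡ; identityʳ; inverseʳ; _\\_; _//_)

  private
    group : Group 0ℓ 0ℓ
    group = record { isGroup = isGroup }

    infix 4 _∈_ _∉_

    _∈_ : Carrier → Subset G → Set
    _∈_ = Defs._∈_ G

    _∉_ : Carrier → Subset G → Set
    _∉_ = Defs._∉_ G

  open GroupProperties group
  open Equivalence using (to; from)
  open ≡-Reasoning

  -- Opaque, so that 'with y ≟ ε' can abstract over it in insertε and deleteε.
  opaque
    _≟_ : DecidableEquality Carrier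
    _≟_ = via-injection (↔⇒↣ enum) Fin._≟_

  ExactlyOneIn : Subset G → (Carrier → Set) → Set
  ExactlyOneIn A P = (∃ λ a → a ∈ A × P a)
                   × (∀ a a′ → a ∈ A → a′ ∈ A → P a → P a′ → a ≡ a′)

  ExactlyOneIn-map : ∀ {A B : Subset G} {P Q : Carrier → Set} (f g : Carrier → Carrier) →
    (∀ a → a ∈ A → P a → f a ∈ B × Q (f a)) →
    (∀ b → b ∈ B → Q b → g b ∈ A × P (g b)) →
    (∀ b → f (g b) ≡ b) →
    ExactlyOneIn A P → ExactlyOneIn B Q
  ExactlyOneIn-map {B = B} {Q = Q} f g f-maps g-maps f∘g≗id ((a , a∈A , Pa) , unique) =
    (f a , f-maps a a∈A Pa) , unique′
    where
    unique′ : ∀ b b′ → b ∈ B → b′ ∈ B → Q b → Q b′ → b ≡ b′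
    unique′ b b′ b∈B b′∈B Qb Qb′ with g-maps b b∈B Qb | g-maps b′ b′∈B Qb′
    ... | gb∈A , Pgb | gb′∈A , Pgb′ = begin
      b         ≡⟨ f∘g≗id b ⟨
      f (g b)   ≡⟨ cong f (unique (g b) (g b′) gb∈A gb′∈A Pgb Pgb′) ⟩
      f (g b′)  ≡⟨ f∘g≗id b′ ⟩
      b′        ∎

  ExactlyOneIn-cong : ∀ {A : Subset G} {P Q : Carrier → Set} →
    (∀ a → P a ⇔ Q a) → ExactlyOneIn A P ⇔ ExactlyOneIn A Q
  ExactlyOneIn-cong {A} {P} {Q} P⇔Q = mk⇔
    (ExactlyOneIn-map id id P⇒Q Q⇒P λ _ → refl)
    (ExactlyOneIn-map id id Q⇒P P⇒Q λ _ → refl)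
    where
    P⇒Q : ∀ a → a ∈ A → P a → a ∈ A × Q a
    P⇒Q a a∈A Pa = a∈A , to (P⇔Q a) Pa

    Q⇒P : ∀ a → a ∈ A → Q a → a ∈ A × P a
    Q⇒P a a∈A Qa = a∈A , from (P⇔Q a) Qa

  ExactlyOneIn-⁻¹ : ∀ {T : Subset G} {P Q : Carrier → Set} → InverseClosed G T →
    (∀ t → P t ⇔ Q (t ⁻¹)) → ExactlyOneIn T Q → ExactlyOneIn T P
  ExactlyOneIn-⁻¹ {Q = Q} T⁻¹ P⇔Q⁻¹ = ExactlyOneIn-map _⁻¹ _⁻¹
    (λ t t∈T Qt → T⁻¹ t t∈T , from (P⇔Q⁻¹ (t ⁻¹)) (subst Q (sym (⁻¹-involutive t)) Qt))
    (λ t t∈T Pt → T⁻¹ t t∈T , to (P⇔Q⁻¹ t) Pt)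
    ⁻¹-involutive

  ExactlyOneIn-selfInverse : ∀ {T : Subset G} {P : Carrier → Set} → InverseClosed G T →
    (∀ t → P t → P (t ⁻¹)) → ExactlyOneIn T P → ∃ λ t → P t × t ⁻¹ ≡ t
  ExactlyOneIn-selfInverse T⁻¹ P⁻¹ ((t , t∈T , Pt) , unique) =
    t , Pt , unique (t ⁻¹) t (T⁻¹ t t∈T) t∈T (P⁻¹ t Pt) Pt

  inverseClosedTransversal⇒¬NoInvolutions : ∀ {T C : Subset G} → InverseClosed G T →
    InverseClosed G C → ε ∉ C → ExactlyOneIn T (_∈ C) → ¬ NoInvolutions G C
  inverseClosedTransversal⇒¬NoInvolutions {C = C} T⁻¹ C⁻¹ ε∉C once noInvolutions
    with ExactlyOneIn-selfInverse T⁻¹ C⁻¹ once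
  ... | t , t∈C , t⁻¹≡t = noInvolutions t t∈C (t≢ε , t∙t≡ε)
    where
    t≢ε : ¬ t ≡ ε
    t≢ε t≡ε = ε∉C (subst (_∈ C) t≡ε t∈C)
    t∙t≡ε : t ∙ t ≡ ε
    t∙t≡ε = trans (cong (t ∙_) (sym t⁻¹≡t)) (inverseʳ t)

  ClosedAdj : Subset G → Carrier → Carrier → Set
  ClosedAdj S c v = c ≡ v ⊎ Adj G S c v

  isPerfectCodeIn⇔uniqueClosedNeighbour : ∀ {S C : Subset G} →
    IsPerfectCodeIn G S C ⇔ (∀ v → ExactlyOneIn C (λ c → ClosedAdj S c v))
  isPerfectCodeIn⇔uniqueClosedNeighbour {S} {C} = mk⇔ uniqueClosedNeighbour perfectCode
    where
    closedAdj⇒adj : ∀ {c v} → v ∉ C → c ∈ C → ClosedAdj S c v → Adj G S c v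
    closedAdj⇒adj v∉C c∈C (inj₁ c≡v) = ⊥-elim (v∉C (subst (_∈ C) c≡v c∈C))
    closedAdj⇒adj v∉C c∈C (inj₂ adj) = adj

    uniqueClosedNeighbour : IsPerfectCodeIn G S C → ∀ v → ExactlyOneIn C (λ c → ClosedAdj S c v)
    uniqueClosedNeighbour (independent , dominating) v with C v Bool.≟ Bool.true
    ... | yes v∈C = (v , v∈C , inj₁ refl) , λ c c′ c∈C c′∈C c~v c′~v →
          trans (closedAdj⇒≡ c∈C c~v) (sym (closedAdj⇒≡ c′∈C c′~v))
      where
      closedAdj⇒≡ : ∀ {c} → c ∈ C → ClosedAdj S c v → c ≡ v
      closedAdj⇒≡ c∈C (inj₁ c≡v) = c≡v
      closedAdj⇒≡ c∈C (inj₂ adj) = ⊥-elim (independent _ v c∈C v∈C adj)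
    ... | no v∉C with dominating v v∉C
    ...   | (c₀ , c₀∈C , adj) , unique = (c₀ , c₀∈C , inj₂ adj) , λ c c′ c∈C c′∈C c~v c′~v →
            unique c c′ c∈C c′∈C (closedAdj⇒adj v∉C c∈C c~v) (closedAdj⇒adj v∉C c′∈C c′~v)

    perfectCode : (∀ v → ExactlyOneIn C (λ c → ClosedAdj S c v)) → IsPerfectCodeIn G S C
    perfectCode once = independent , dominating
      where
      independent : ∀ x y → x ∈ C → y ∈ C → ¬ Adj G S x y
      independent x y x∈C y∈C (x≢y , y∙x⁻¹∈S) =
        x≢y (proj₂ (once y) x y x∈C y∈C (inj₂ (x≢y , y∙x⁻¹∈S)) (inj₁ refl))

      dominating : ∀ v → v ∉ C → ExactlyOneIn C (λ c → Adj G S c v)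
      dominating v v∉C with once v
      ... | (c₀ , c₀∈C , c₀~v) , unique =
            (c₀ , c₀∈C , closedAdj⇒adj v∉C c₀∈C c₀~v) , λ c c′ c∈C c′∈C adj adj′ →
            unique c c′ c∈C c′∈C (inj₂ adj) (inj₂ adj′)

  ExtendsByε : Subset G → Subset G → Set
  ExtendsByε S T = ∀ y → y ∈ T ⇔ (y ≡ ε ⊎ y ∈ S)

  closedAdj⇔∈ : ∀ {S T : Subset G} {c v} → ExtendsByε S T → ClosedAdj S c v ⇔ v ∙ c ⁻¹ ∈ T
  closedAdj⇔∈ {S} {T} {c} {v} T≐S∪ε = mk⇔ closedAdj⇒∈ ∈⇒closedAdj
    where
    closedAdj⇒∈ : ClosedAdj S c v → v ∙ c ⁻¹ ∈ T
    closedAdj⇒∈ (inj₁ c≡v) = from (T≐S∪ε _) (inj₁ (x≈y⇒x∙y⁻¹≈ε (sym c≡v)))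
    closedAdj⇒∈ (inj₂ (_ , v∙c⁻¹∈S)) = from (T≐S∪ε _) (inj₂ v∙c⁻¹∈S)

    ∈⇒closedAdj : v ∙ c ⁻¹ ∈ T → ClosedAdj S c v
    ∈⇒closedAdj v∙c⁻¹∈T with to (T≐S∪ε _) v∙c⁻¹∈T | c ≟ v
    ... | inj₁ v∙c⁻¹≡ε | _       = inj₁ (sym (x∙y⁻¹≈ε⇒x≈y v c v∙c⁻¹≡ε))
    ... | inj₂ _       | yes c≡v = inj₁ c≡v
    ... | inj₂ v∙c⁻¹∈S | no c≢v  = inj₂ (c≢v , v∙c⁻¹∈S)

  insertε : Subset G → Subset G
  insertε S y = does (y ≟ ε) ∨ S y

  deleteε : Subset G → Subset G
  deleteε T y = not (does (y ≟ ε)) ∧ T y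

  insertε-extends : ∀ {S : Subset G} → ExtendsByε S (insertε S)
  insertε-extends {S} y with y ≟ ε
  ... | yes y≡ε = mk⇔ (λ _ → inj₁ y≡ε) (λ _ → refl)
  ... | no y≢ε  = mk⇔ inj₂ [ (λ y≡ε → ⊥-elim (y≢ε y≡ε)) , id ]

  deleteε-extends : ∀ {T : Subset G} → ε ∈ T → ExtendsByε (deleteε T) T
  deleteε-extends {T} ε∈T y with y ≟ ε
  ... | yes y≡ε = mk⇔ (λ _ → inj₁ y≡ε) [ (λ y≡ε → subst (_∈ T) (sym y≡ε) ε∈T) , (λ ()) ]
  ... | no y≢ε  = mk⇔ inj₂ [ (λ y≡ε → ⊥-elim (y≢ε y≡ε)) , id ]

  ε∉deleteε : ∀ {T : Subset G} → ε ∉ deleteε T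
  ε∉deleteε with ε ≟ ε
  ... | yes _   = λ ()
  ... | no ε≢ε  = ⊥-elim (ε≢ε refl)

  ExtendsByε⇒ε∈ : ∀ {S T : Subset G} → ExtendsByε S T → ε ∈ T
  ExtendsByε⇒ε∈ T≐S∪ε = from (T≐S∪ε ε) (inj₁ refl)

  ExtendsByε⇒InverseClosed : ∀ {S T : Subset G} → ExtendsByε S T →
    InverseClosed G S → InverseClosed G T
  ExtendsByε⇒InverseClosed T≐S∪ε S⁻¹ y y∈T with to (T≐S∪ε y) y∈T
  ... | inj₁ y≡ε = from (T≐S∪ε (y ⁻¹)) (inj₁ (trans (cong _⁻¹ y≡ε) ε⁻¹≈ε))
  ... | inj₂ y∈S = from (T≐S∪ε (y ⁻¹)) (inj₂ (S⁻¹ y y∈S))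

  ExtendsByε⇒InverseClosed⁻ : ∀ {S T : Subset G} → ExtendsByε S T → ε ∉ S →
    InverseClosed G T → InverseClosed G S
  ExtendsByε⇒InverseClosed⁻ {S} T≐S∪ε ε∉S T⁻¹ y y∈S
    with to (T≐S∪ε (y ⁻¹)) (T⁻¹ y (from (T≐S∪ε y) (inj₂ y∈S)))
  ... | inj₁ y⁻¹≡ε = ⊥-elim (ε∉S (subst (_∈ S) y≡ε y∈S))
    where
    y≡ε : y ≡ ε
    y≡ε = ⁻¹-injective (trans y⁻¹≡ε (sym ε⁻¹≈ε))
  ... | inj₂ y⁻¹∈S = y⁻¹∈S

  inverseClosed-∈ : ∀ {H : Subset G} {a b} → InverseClosed G H → a ⁻¹ ≡ b → a ∈ H → b ∈ H
  inverseClosed-∈ {H} H⁻¹ a⁻¹≡b a∈H = subst (_∈ H) a⁻¹≡b (H⁻¹ _ a∈H)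

  inverseClosed-∈⇔ : ∀ {H : Subset G} {a b} → InverseClosed G H → a ⁻¹ ≡ b → a ∈ H ⇔ b ∈ H
  inverseClosed-∈⇔ {a = a} {b} H⁻¹ a⁻¹≡b =
    mk⇔ (inverseClosed-∈ H⁻¹ a⁻¹≡b) (inverseClosed-∈ H⁻¹ b⁻¹≡a)
    where
    b⁻¹≡a : b ⁻¹ ≡ a
    b⁻¹≡a = trans (cong _⁻¹ (sym a⁻¹≡b)) (⁻¹-involutive a)

  uniqueRightFactor⇔uniqueCosetRepresentative : ∀ {H T : Subset G} {v} → InverseClosed G H →
    ExactlyOneIn H (λ c → v ∙ c ⁻¹ ∈ T) ⇔ ExactlyOneIn T (_∈ leftCoset G v H)
  uniqueRightFactor⇔uniqueCosetRepresentative {H} {T} {v} H⁻¹ = mk⇔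
    (ExactlyOneIn-map (v //_) (_\\ v) factor⇒representative representative⇒factor v∙[t⁻¹∙v]⁻¹≡t)
    (ExactlyOneIn-map (_\\ v) (v //_) representative⇒factor factor⇒representative [v∙c⁻¹]⁻¹∙v≡c)
    where
    v∙[t⁻¹∙v]⁻¹≡t : ∀ t → v // (t \\ v) ≡ t
    v∙[t⁻¹∙v]⁻¹≡t t = trans (cong (v ∙_) (⁻¹-anti-homo-\\ t v)) (\\-leftDividesˡ v t)

    [v∙c⁻¹]⁻¹∙v≡c : ∀ c → (v // c) \\ v ≡ c
    [v∙c⁻¹]⁻¹∙v≡c c = trans (cong (_∙ v) (⁻¹-anti-homo-// v c)) (//-rightDividesˡ v c)

    factor⇒representative : ∀ c → c ∈ H → v // c ∈ T → v // c ∈ T × v // c ∈ leftCoset G v H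
    factor⇒representative c c∈H v∙c⁻¹∈T =
      v∙c⁻¹∈T , subst (_∈ H) (sym (\\-leftDividesʳ v (c ⁻¹))) (H⁻¹ c c∈H)

    representative⇒factor : ∀ t → t ∈ T → t ∈ leftCoset G v H → t \\ v ∈ H × v // (t \\ v) ∈ T
    representative⇒factor t t∈T v⁻¹∙t∈H =
      inverseClosed-∈ H⁻¹ (⁻¹-anti-homo-\\ v t) v⁻¹∙t∈H , subst (_∈ T) (sym (v∙[t⁻¹∙v]⁻¹≡t t)) t∈T

  isPerfectCodeIn⇔isLeftTransversal : ∀ {H S T : Subset G} → InverseClosed G H → ExtendsByε S T →
    IsPerfectCodeIn G S H ⇔ IsLeftTransversal G H T
  isPerfectCodeIn⇔isLeftTransversal {H} {S} {T} H⁻¹ T≐S∪ε = mk⇔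
    (λ perfect v → to (factorisation v) (to (closedNeighbour v) (to perfectCode perfect v)))
    (λ transversal → from perfectCode λ v →
       from (closedNeighbour v) (from (factorisation v) (transversal v)))
    where
    perfectCode : IsPerfectCodeIn G S H ⇔ (∀ v → ExactlyOneIn H (λ c → ClosedAdj S c v))
    perfectCode = isPerfectCodeIn⇔uniqueClosedNeighbour {S} {H}

    closedNeighbour : ∀ v →
      ExactlyOneIn H (λ c → ClosedAdj S c v) ⇔ ExactlyOneIn H (λ c → v ∙ c ⁻¹ ∈ T)
    closedNeighbour v = ExactlyOneIn-cong (λ c → closedAdj⇔∈ T≐S∪ε)

    factorisation : ∀ v →
      ExactlyOneIn H (λ c → v ∙ c ⁻¹ ∈ T) ⇔ ExactlyOneIn T (_∈ leftCoset G v H)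
    factorisation v = uniqueRightFactor⇔uniqueCosetRepresentative H⁻¹

  isPerfectCodeOf⇔inverseClosedLeftTransversal : ∀ {H : Subset G} → InverseClosed G H →
    IsPerfectCodeOf G H ⇔ (∃ λ T → IsLeftTransversal G H T × ε ∈ T × InverseClosed G T)
  isPerfectCodeOf⇔inverseClosedLeftTransversal H⁻¹ = mk⇔
    (λ (S , (S⁻¹ , _) , perfect) → let T≐S∪ε = insertε-extends {S} in
       insertε S , to (isPerfectCodeIn⇔isLeftTransversal H⁻¹ T≐S∪ε) perfect
                 , ExtendsByε⇒ε∈ T≐S∪ε , ExtendsByε⇒InverseClosed T≐S∪ε S⁻¹)
    (λ (T , transversal , ε∈T , T⁻¹) → let T≐S∪ε = deleteε-extends ε∈T in
       deleteε T , (ExtendsByε⇒InverseClosed⁻ T≐S∪ε (ε∉deleteε {T}) T⁻¹ , ε∉deleteε {T})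
                 , from (isPerfectCodeIn⇔isLeftTransversal H⁻¹ T≐S∪ε) transversal)

  ∈leftCoset⇔⁻¹∈rightCoset : ∀ {H : Subset G} {x t} → InverseClosed G H →
    t ∈ leftCoset G x H ⇔ t ⁻¹ ∈ rightCoset G H (x ⁻¹)
  ∈leftCoset⇔⁻¹∈rightCoset {x = x} {t} H⁻¹ = inverseClosed-∈⇔ H⁻¹ (⁻¹-anti-homo-∙ (x ⁻¹) t)

  ∈rightCoset⇔⁻¹∈leftCoset : ∀ {H : Subset G} {x t} → InverseClosed G H →
    t ∈ rightCoset G H x ⇔ t ⁻¹ ∈ leftCoset G (x ⁻¹) H
  ∈rightCoset⇔⁻¹∈leftCoset {x = x} {t} H⁻¹ = inverseClosed-∈⇔ H⁻¹ (⁻¹-anti-homo-∙ t (x ⁻¹))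

  rightTransversal⇒leftTransversal : ∀ {H T : Subset G} → InverseClosed G H → InverseClosed G T →
    IsRightTransversal G H T → IsLeftTransversal G H T
  rightTransversal⇒leftTransversal H⁻¹ T⁻¹ transversal x =
    ExactlyOneIn-⁻¹ T⁻¹ (λ t → ∈leftCoset⇔⁻¹∈rightCoset H⁻¹) (transversal (x ⁻¹))

  leftTransversal⇒rightTransversal : ∀ {H T : Subset G} → InverseClosed G H → InverseClosed G T →
    IsLeftTransversal G H T → IsRightTransversal G H T
  leftTransversal⇒rightTransversal H⁻¹ T⁻¹ transversal x =
    ExactlyOneIn-⁻¹ T⁻¹ (λ t → ∈rightCoset⇔⁻¹∈leftCoset H⁻¹) (transversal (x ⁻¹))

  ε∉leftCoset : ∀ {H : Subset G} {x} → InverseClosed G H → x ∉ H → ε ∉ leftCoset G x H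
  ε∉leftCoset {x = x} H⁻¹ x∉H x⁻¹∙ε∈H =
    x∉H (inverseClosed-∈ H⁻¹ (trans (cong _⁻¹ (identityʳ (x ⁻¹))) (⁻¹-involutive x)) x⁻¹∙ε∈H)

  ε∉rightCoset : ∀ {H : Subset G} {x} → InverseClosed G H → x ∉ H → ε ∉ rightCoset G H x
  ε∉rightCoset {x = x} H⁻¹ x∉H ε∙x⁻¹∈H =
    x∉H (inverseClosed-∈ H⁻¹ (trans (cong _⁻¹ (identityˡ (x ⁻¹))) (⁻¹-involutive x)) ε∙x⁻¹∈H)

open Defs using (_∈_; _∉_)

corollary2p3 : (G : FiniteGroup) → (H : Subset G) → IsProperSubgroup G H →
    (IsPerfectCodeOf G H
      ⇔ (∃ λ T → (IsLeftTransversal G H T ⊎ IsRightTransversal G H T)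
                  × _∈_ G (FiniteGroup.ε G) T × InverseClosed G T))
    × ((∃ λ x → _∉_ G x H
         × ((InverseClosed G (leftCoset G x H) × NoInvolutions G (leftCoset G x H))
            ⊎ (InverseClosed G (rightCoset G H x) × NoInvolutions G (rightCoset G H x))))
       → ¬ IsPerfectCodeOf G H)
corollary2p3 G H ((_ , _ , H⁻¹) , _) =
    mk⇔ (λ perfect → let (T , transversal , ε∈T , T⁻¹) = to perfect in
                     T , inj₁ transversal , ε∈T , T⁻¹)
        (λ (T , transversal , ε∈T , T⁻¹) →
           from (T , [ id , rightTransversal⇒leftTransversal G H⁻¹ T⁻¹ ] transversal , ε∈T , T⁻¹))
  , λ where
      (x , x∉H , inj₁ (xH⁻¹ , noInvolutions)) perfect →
        let (T , transversal , _ , T⁻¹) = to perfect in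
        inverseClosedTransversal⇒¬NoInvolutions G T⁻¹ xH⁻¹ (ε∉leftCoset G H⁻¹ x∉H)
          (transversal x) noInvolutions
      (x , x∉H , inj₂ (Hx⁻¹ , noInvolutions)) perfect →
        let (T , transversal , _ , T⁻¹) = to perfect in
        inverseClosedTransversal⇒¬NoInvolutions G T⁻¹ Hx⁻¹ (ε∉rightCoset G H⁻¹ x∉H)
          (leftTransversal⇒rightTransversal G H⁻¹ T⁻¹ transversal x) noInvolutions
  where
  open Equivalence (isPerfectCodeOf⇔inverseClosedLeftTransversal G H⁻¹)
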